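{- Let $r$ be a real number. If there exists $u\in\mathbb{N}$ such that $\frac{s_2(u^2)}{s_2(u)}=r$, then there exists $v\in\mathbb{N}$ such that $\frac{s_2(v^2)}{s_2(v)}=\frac{3}{2}r$.
   Context: $s_2(n)$ denotes the sum of the binary digits of $n$.
   Formalization: The number r ranges over the rationals instead of the reals. -}

module Defs where

open import Data.Nat using (ℕ; zero; suc; _+_; _*_; _^_; NonZero)
open import Data.Nat.DivMod using (_/_; _%_)
open import Data.Integer using (+_)
import Data.Rational as ℚ
open ℚ using (ℚ)

-- digit sum in base 2 with fuel: each step removes the last binary digit.
-- With fuel n the recursion fully consumes n (n has at most n binary digits).
s₂-aux : ℕ → ℕ → ℕ
s₂-aux zero     n = 0
s₂-aux (suc f)  n = n % 2 + s₂-aux f (n / 2)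

s₂ : ℕ → ℕ
s₂ n = s₂-aux n n

ratio : (u : ℕ) → .{{NonZero (s₂ u)}} → ℚ
ratio u = (+ s₂ (u ^ 2)) ℚ./ s₂ u

module Submission where

-- Writing a number in binary, if b < 2 ^ k then the digits of
-- b + a * 2 ^ k are those of b followed by those of a, so
--   s₂ (b + a * 2 ^ k) = s₂ b + s₂ a                           (s₂-concat).
-- Given u, pick k so large that u and 2 u ^ 2 (hence u ^ 2) are below 2 ^ k, and
-- put v = u + u * 2 ^ k (two copies of the binary word of u).  Then
--   s₂ v = 2 s₂ u,   and   v ^ 2 = u ^ 2 + (2 u ^ 2 + u ^ 2 * 2 ^ k) * 2 ^ k
-- consists of three non-overlapping blocks u ^ 2, 2 u ^ 2, u ^ 2, whence
-- s₂ (v ^ 2) = 3 s₂ (u ^ 2) (doubling does not change s₂).  Thus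
--   s₂ (v ^ 2) / s₂ v = (3/2) · s₂ (u ^ 2) / s₂ u.

open import Defs
open import Data.Nat using (ℕ; NonZero)
open import Data.Integer using (+_)
open import Data.Rational using (ℚ; _/_; _*_)
open import Data.Product using (Σ; ∃)
open import Relation.Binary.PropositionalEquality using (_≡_)

open import Data.Nat as ℕ using (zero; suc; _≤_; _<_; z≤n; s≤s; _^_; _%_)
open import Data.Nat.Properties
open import Data.Nat.DivMod
  using ([m+kn]%n≡m%n; m*n%n≡0; m%n<n; m<n*o⇒m/o<n; +-distrib-/; m*n/n≡m; m/n<m)
open import Data.Nat.Solver using (module +-*-Solver)
import Data.Integer as ℤ
import Data.Integer.Properties as ℤ
open import Data.Rational using (toℚᵘ)
open import Data.Rational.Properties using (toℚᵘ-injective; toℚᵘ-fromℚᵘ; toℚᵘ-homo-*; /-cong)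
import Data.Rational.Unnormalised as ℚᵘ
import Data.Rational.Unnormalised.Properties as ℚᵘ
open import Data.Product using (_,_)
open import Relation.Binary.PropositionalEquality
  using (refl; sym; trans; cong; cong₂; subst; module ≡-Reasoning)

s₂-aux-zero : ∀ f → s₂-aux f 0 ≡ 0
s₂-aux-zero zero    = refl
s₂-aux-zero (suc f) = s₂-aux-zero f

half-≤ : ∀ n f → n ≤ suc f → n ℕ./ 2 ≤ f
half-≤ zero    f _   = z≤n
half-≤ (suc m) f n≤f = ≤-pred (≤-trans (m/n<m (suc m) 2 (s≤s (s≤s z≤n))) n≤f)

s₂-aux-fuel : ∀ f g n → n ≤ f → n ≤ g → s₂-aux f n ≡ s₂-aux g n
s₂-aux-fuel zero    g       .0 z≤n _   = sym (s₂-aux-zero g)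
s₂-aux-fuel (suc f) zero    .0 _   z≤n = s₂-aux-zero (suc f)
s₂-aux-fuel (suc f) (suc g) n  n≤f n≤g =
  cong (n % 2 ℕ.+_) (s₂-aux-fuel f g (n ℕ./ 2) (half-≤ n f n≤f) (half-≤ n g n≤g))

s₂-step : ∀ n → s₂ n ≡ n % 2 ℕ.+ s₂ (n ℕ./ 2)
s₂-step zero    = refl
s₂-step (suc m) = cong (suc m % 2 ℕ.+_)
  (s₂-aux-fuel m (suc m ℕ./ 2) (suc m ℕ./ 2) (half-≤ (suc m) m ≤-refl) ≤-refl)

[b+x*2]/2≡b/2+x : ∀ b x → (b ℕ.+ x ℕ.* 2) ℕ./ 2 ≡ b ℕ./ 2 ℕ.+ x
[b+x*2]/2≡b/2+x b x = trans (+-distrib-/ b (x ℕ.* 2) no-carry) (cong (b ℕ./ 2 ℕ.+_) (m*n/n≡m x 2))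
  where
  no-carry : b % 2 ℕ.+ (x ℕ.* 2) % 2 < 2
  no-carry = subst (λ r → b % 2 ℕ.+ r < 2) (sym (m*n%n≡0 x 2))
               (subst (_< 2) (sym (+-identityʳ (b % 2))) (m%n<n b 2))

s₂-concat : ∀ k a b → b < 2 ^ k → s₂ (b ℕ.+ a ℕ.* 2 ^ k) ≡ s₂ b ℕ.+ s₂ a
s₂-concat zero    a .0 (s≤s z≤n) = cong s₂ (*-identityʳ a)
s₂-concat (suc k) a b b<2^k+1 = begin
    s₂ (b ℕ.+ a ℕ.* 2 ^ suc k)                  ≡⟨ cong (λ z → s₂ (b ℕ.+ z)) shift ⟩
    s₂ (b ℕ.+ x ℕ.* 2)                           ≡⟨ s₂-step (b ℕ.+ x ℕ.* 2) ⟩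
    (b ℕ.+ x ℕ.* 2) % 2 ℕ.+ s₂ ((b ℕ.+ x ℕ.* 2) ℕ./ 2)
      ≡⟨ cong₂ ℕ._+_ ([m+kn]%n≡m%n b x 2) (cong s₂ ([b+x*2]/2≡b/2+x b x)) ⟩
    b % 2 ℕ.+ s₂ (b ℕ./ 2 ℕ.+ x)                 ≡⟨ cong (b % 2 ℕ.+_) (s₂-concat k a (b ℕ./ 2) b/2<2^k) ⟩
    b % 2 ℕ.+ (s₂ (b ℕ./ 2) ℕ.+ s₂ a)            ≡⟨ sym (+-assoc (b % 2) _ _) ⟩
    (b % 2 ℕ.+ s₂ (b ℕ./ 2)) ℕ.+ s₂ a            ≡⟨ cong (ℕ._+ s₂ a) (sym (s₂-step b)) ⟩
    s₂ b ℕ.+ s₂ a                                ∎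
  where
  open ≡-Reasoning
  x : ℕ
  x = a ℕ.* 2 ^ k
  shift : a ℕ.* 2 ^ suc k ≡ x ℕ.* 2
  shift = trans (cong (a ℕ.*_) (*-comm 2 (2 ^ k))) (sym (*-assoc a (2 ^ k) 2))
  b/2<2^k : b ℕ./ 2 < 2 ^ k
  b/2<2^k = m<n*o⇒m/o<n (subst (b <_) (*-comm 2 (2 ^ k)) b<2^k+1)

s₂-shift : ∀ k a → s₂ (a ℕ.* 2 ^ k) ≡ s₂ a
s₂-shift k a = s₂-concat k a 0 (m^n>0 2 k)

n<2^n : ∀ n → n < 2 ^ n
n<2^n zero    = s≤s z≤n
n<2^n (suc n) = subst (_≤ 2 ^ suc n) (+-comm (suc n) 1)
  (+-mono-≤ (n<2^n n) (≤-trans (m^n>0 2 n) (m≤m+n (2 ^ n) 0)))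

twice : ℕ → ℕ → ℕ
twice k u = u ℕ.+ u ℕ.* 2 ^ k

s₂-twice : ∀ k u → u < 2 ^ k → s₂ (twice k u) ≡ 2 ℕ.* s₂ u
s₂-twice k u u<2^k = trans (s₂-concat k u u u<2^k) (cong (s₂ u ℕ.+_) (sym (+-identityʳ (s₂ u))))

open +-*-Solver

square-blocks : ∀ u P → (u ℕ.+ u ℕ.* P) ^ 2 ≡ u ^ 2 ℕ.+ (u ^ 2 ℕ.* 2 ℕ.+ u ^ 2 ℕ.* P) ℕ.* P
square-blocks = solve 2 (λ u P → (u :+ u :* P) :^ 2 := u :^ 2 :+ (u :^ 2 :* con 2 :+ u :^ 2 :* P) :* P) refl

-- When 2u² < 2^k the three blocks u², 2u², u² of (twice k u)² do not
-- overlap, and each has digit sum s₂ (u²).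
s₂-twice-square : ∀ k u → u ^ 2 ℕ.* 2 < 2 ^ k → s₂ (twice k u ^ 2) ≡ 3 ℕ.* s₂ (u ^ 2)
s₂-twice-square k u 2u²<P = begin
    s₂ (twice k u ^ 2)                                  ≡⟨ cong s₂ (square-blocks u P) ⟩
    s₂ (u ^ 2 ℕ.+ (u ^ 2 ℕ.* 2 ℕ.+ u ^ 2 ℕ.* P) ℕ.* P)   ≡⟨ s₂-concat k (u ^ 2 ℕ.* 2 ℕ.+ u ^ 2 ℕ.* P) (u ^ 2) u²<P ⟩
    s ℕ.+ s₂ (u ^ 2 ℕ.* 2 ℕ.+ u ^ 2 ℕ.* P)              ≡⟨ cong (s ℕ.+_) (s₂-concat k (u ^ 2) _ 2u²<P) ⟩
    s ℕ.+ (s₂ (u ^ 2 ℕ.* 2) ℕ.+ s)                      ≡⟨ cong (λ z → s ℕ.+ (z ℕ.+ s)) (s₂-shift 1 (u ^ 2)) ⟩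
    s ℕ.+ (s ℕ.+ s)                                     ≡⟨ cong (λ z → s ℕ.+ (s ℕ.+ z)) (sym (+-identityʳ s)) ⟩
    3 ℕ.* s                                             ∎
  where
  open ≡-Reasoning
  P : ℕ
  P = 2 ^ k
  s : ℕ
  s = s₂ (u ^ 2)
  u²<P : u ^ 2 < P
  u²<P = ≤-<-trans (m≤m*n (u ^ 2) 2) 2u²<P

-- A block length that is large enough for both lemmas above.
width : ℕ → ℕ
width u = u ℕ.+ u ^ 2 ℕ.* 2

u<2^width : ∀ u → u < 2 ^ width u
u<2^width u = ≤-<-trans (m≤m+n u (u ^ 2 ℕ.* 2)) (n<2^n (width u))

2u²<2^width : ∀ u → u ^ 2 ℕ.* 2 < 2 ^ width u
2u²<2^width u = ≤-<-trans (m≤n+m (u ^ 2 ℕ.* 2) u) (n<2^n (width u))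

toℚᵘ-/ : ∀ i n .{{_ : NonZero n}} → toℚᵘ (i / n) ℚᵘ.≃ (i ℚᵘ./ n)
toℚᵘ-/ i (suc n) = toℚᵘ-fromℚᵘ (ℚᵘ.mkℚᵘ i n)

/-*-/ : ∀ i j m n .{{_ : NonZero m}} .{{_ : NonZero n}} →
        (i / m) * (j / n) ≡ ((i ℤ.* j) / (m ℕ.* n)) {{m*n≢0 m n}}
/-*-/ i j m@(suc _) n@(suc _) = toℚᵘ-injective (begin
    toℚᵘ ((i / m) * (j / n))          ≈⟨ toℚᵘ-homo-* (i / m) (j / n) ⟩
    toℚᵘ (i / m) ℚᵘ.* toℚᵘ (j / n)     ≈⟨ ℚᵘ.*-cong (toℚᵘ-/ i m) (toℚᵘ-/ j n) ⟩
    (i ℚᵘ./ m) ℚᵘ.* (j ℚᵘ./ n)        ≈⟨ ℚᵘ.≃-sym (toℚᵘ-/ (i ℤ.* j) (m ℕ.* n)) ⟩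
    toℚᵘ ((i ℤ.* j) / (m ℕ.* n))      ∎)
  where open ℚᵘ.≃-Reasoning

ratio-scale : ∀ u v .{{_ : NonZero (s₂ u)}} .{{_ : NonZero (s₂ v)}} →
              s₂ (v ^ 2) ≡ 3 ℕ.* s₂ (u ^ 2) → s₂ v ≡ 2 ℕ.* s₂ u →
              ratio v ≡ (+ 3 / 2) * ratio u
ratio-scale u v sq-eq eq = begin
    (+ s₂ (v ^ 2)) / s₂ v                       ≡⟨ /-cong (cong +_ sq-eq) eq ⟩
    (+ (3 ℕ.* s₂ (u ^ 2))) / (2 ℕ.* s₂ u)        ≡⟨ /-cong (ℤ.pos-* 3 (s₂ (u ^ 2))) refl ⟩
    (+ 3 ℤ.* + s₂ (u ^ 2)) / (2 ℕ.* s₂ u)        ≡⟨ sym (/-*-/ (+ 3) (+ s₂ (u ^ 2)) 2 (s₂ u)) ⟩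
    (+ 3 / 2) * ((+ s₂ (u ^ 2)) / s₂ u)          ∎
  where
  open ≡-Reasoning
  instance
    2s₂u≢0 : NonZero (2 ℕ.* s₂ u)
    2s₂u≢0 = m*n≢0 2 (s₂ u)

lemma2p3 : (r : ℚ) →
    (∃ λ u → Σ (NonZero (s₂ u)) λ nz → ratio u {{nz}} ≡ r) →
    ∃ λ v → Σ (NonZero (s₂ v)) λ nz → ratio v {{nz}} ≡ (+ 3 / 2) * r
lemma2p3 r (u , nz , ratio-u≡r) =
  v , nz-v , trans (ratio-scale u v {{nz}} {{nz-v}} sq-eq eq) (cong ((+ 3 / 2) *_) ratio-u≡r)
  where
  k : ℕ
  k = width u
  v : ℕ
  v = twice k u
  eq : s₂ v ≡ 2 ℕ.* s₂ u
  eq = s₂-twice k u (u<2^width u)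
  sq-eq : s₂ (v ^ 2) ≡ 3 ℕ.* s₂ (u ^ 2)
  sq-eq = s₂-twice-square k u (2u²<2^width u)
  nz-v : NonZero (s₂ v)
  nz-v = subst NonZero (sym eq) (m*n≢0 2 (s₂ u) {{_}} {{nz}})
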